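{- Let $n>1$ and $m$ be integers with $0<m<n$, and let $\mathcal{F}(n,m)=(\tfrac{h}{k}\in\mathcal{F}_n:\ h\le m,\ k-h\le n-m)$. Then $|\mathcal{F}(n,m)|=|\mathcal{F}_{n-m}^m|+|\mathcal{F}^{n-m}_m|-1$ and $|\mathcal{F}(n,m)|-2=\sum_{d\ge1}\overline{\mu}(d)\left\lfloor\tfrac{m}{d}\right\rfloor\left\lfloor\tfrac{n-m}{d}\right\rfloor.$ In particular, for every positive integer $t$, $\sum_{d\ge1}\overline{\mu}(d)\left\lfloor\tfrac{t}{d}\right\rfloor^2=|\mathcal{F}(2t,t)|-2=2|\mathcal{F}_t|-3$.
   Context: For an integer $q\ge1$, the Farey sequence $\mathcal{F}_q$ is the ascending sequence of all irreducible fractions $\tfrac hk$ (with $h\ge0$, $k\ge1$, $\gcd(h,k)=1$) such that $\tfrac01\le\tfrac hk\le\tfrac11$ and $1\le k\le q$. For integers $q\ge1$ and $p$, $\mathcal{F}_q^p=(\tfrac hk\in\mathcal{F}_q:\ h\le p)$. $\overline{\mu}$ denotes the number-theoretic Möbius function on positive integers, and $|\cdot|$ denotes the number of elements of a sequence. -}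

module Defs where

open import Data.Nat using (ℕ; zero; suc; _+_; _*_; _∸_; _≤_; _≤?_; _/_)
open import Data.Nat.GCD using (gcd)
open import Data.Nat.Divisibility using (_∣_; _∣?_)
open import Data.Nat.Primality using (Prime; prime?)
open import Data.Integer as ℤ using (ℤ; +_; -_)
open import Data.List using (List; []; _∷_; map; concatMap; filter; upTo; length; foldr)
open import Data.Bool.ListAction using (any)
open import Data.Product using (_×_; _,_; proj₁; proj₂)
open import Data.Bool using (Bool; true; false; if_then_else_)
open import Relation.Nullary.Decidable using (⌊_⌋; _×-dec_)
import Data.Nat as ℕ

range : ℕ → ℕ → List ℕ
range a b = map (λ i → a + i) (upTo (suc b ∸ a))

-- A fraction h/k is represented by the pair (h , k).
Frac : Set
Frac = ℕ × ℕ

-- Only its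
-- cardinality is used in the theorem, so the ordering is immaterial.
Farey : ℕ → List Frac
Farey q = filter (λ x → gcd (proj₁ x) (proj₂ x) ℕ.≟ 1)
            (concatMap (λ k → map (λ h → (h , k)) (range 0 k)) (range 1 q))

FareyP : ℕ → ℕ → List Frac
FareyP q p = filter (λ x → proj₁ x ≤? p) (Farey q)

FareyNM : ℕ → ℕ → List Frac
FareyNM n m = filter (λ x → (proj₁ x ≤? m) ×-dec (proj₂ x ∸ proj₁ x ≤? n ∸ m)) (Farey n)

primeDivisors : ℕ → List ℕ
primeDivisors d = filter (λ p → prime? p ×-dec (p ∣? d)) (range 2 d)

squareful : ℕ → Bool
squareful d = any (λ p → ⌊ (p * p) ∣? d ⌋) (primeDivisors d)

negPow : ℕ → ℤ
negPow zero = + 1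
negPow (suc k) = - negPow k

μ : ℕ → ℤ
μ d = if squareful d then + 0 else negPow (length (primeDivisors d))

sumℤ : List ℤ → ℤ
sumℤ = foldr ℤ._+_ (+ 0)

-- Σ_{d ≥ 1} μ(d) ⌊a/d⌋ ⌊b/d⌋.  All terms with d > a vanish (⌊a/d⌋ = 0),
-- so the sum over d = 1 .. a is the full (finitely supported) sum.
mobiusSum : ℕ → ℕ → ℤ
mobiusSum a b = sumℤ (map (λ d → μ (suc d) ℤ.* (+ ((a / suc d) * (b / suc d)))) (upTo a))

-- Apart from 0/1 and 1/1, the shear (h , k) ↦ (h , k − h) maps F(n,m) bijectively onto the
-- coprime pairs in [1,m] × [1,n−m]. With p = m and q = n − m, F_q^p without 0/1 consists of the
-- coprime pairs (h , k) ∈ [1,p] × [1,q] with h ≤ k, and swapping coordinates maps F_p^q without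
-- 0/1 and 1/1 onto those with h > k; hence |F_q^p| + |F_p^q| = |F(n,m)| + 1. Coprime pairs are
-- counted by Möbius inversion, [gcd(h,k) = 1] = Σ_{d ∣ h, d ∣ k} μ(d), there being ⌊m/d⌋
-- multiples of d in [1,m]; the inner identity Σ_{d ∣ g} μ(d) = 0 for g > 1 comes from pairing
-- the divisors of g not divisible by a prime p ∣ g with their p-multiples. For n = 2t, m = t
-- both Farey subsequences are F_t^t = F_t.
module Submission where

open import Data.Bool using (Bool; true; false; T; if_then_else_)
open import Data.Bool.Properties using (T-≡)
open import Data.Empty using (⊥; ⊥-elim)
open import Data.Integer using (ℤ; +_; -_)
import Data.Integer.Properties as ℤ
open import Data.Integer.Tactic.RingSolver using (solve-∀)
open import Data.List
  using (List; []; _∷_; length; map; filter; concatMap; cartesianProduct; applyUpTo; upTo; _++_)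
open import Data.List.Membership.Propositional using (_∈_; _∉_; find; lose)
open import Data.List.Membership.Propositional.Properties
open import Data.List.Membership.Propositional.Properties.WithK using (unique∧set⇒bag)
open import Data.List.Properties using (length-map; map-++; map-∘; map-applyUpTo; filter-all)
open import Data.List.Relation.Binary.BagAndSetEquality using (∼bag⇒↭)
open import Data.List.Relation.Binary.Permutation.Propositional.Properties using (↭-length)
open import Data.List.Relation.Unary.All as All using (All; _∷_)
open import Data.List.Relation.Unary.AllPairs using ([]; _∷_)
open import Data.List.Relation.Unary.Any using (here; there)
open import Data.List.Relation.Unary.Any.Properties using (any⁺; any⁻)
open import Data.List.Relation.Unary.Unique.Propositional using (Unique)
import Data.List.Relation.Unary.Unique.Propositional.Properties as Unique
open import Data.Nat
  using (ℕ; zero; suc; _≤_; _<_; _∸_; _≤?_; _≟_; _/_; _%_; z≤n; s≤s; NonZero; >-nonZero; nonTrivial⇒n>1)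
import Data.Nat as ℕ
open import Data.Nat.Coprimality using (Coprime; coprime-divisor)
import Data.Nat.Coprimality as Coprime
open import Data.Nat.Divisibility
  using ( _∣_; _∣?_; ∣⇒≤; ∣-refl; ∣-antisym; ∣-trans; ∣m+n∣m⇒∣n; ∣m∣n⇒∣m+n; m∣m*n; ∣n⇒∣m*n
        ; *-monoʳ-∣; *-cancelˡ-∣; quotient; quotient≢0; m∣n⇒n≡m*quotient)
open import Data.Nat.DivMod using (m≡m%n+[m/n]*n; m%n<n)
open import Data.Nat.GCD
  using (gcd; gcd[m,n]∣m; gcd[m,n]∣n; gcd-greatest; gcd[m,n]≢0; gcd-identityˡ; gcd-comm)
open import Data.Nat.ListAction using (product)
open import Data.Nat.Primality
  using (Prime; prime?; ¬prime[1]; prime⇒irreducible; prime⇒nonZero; prime⇒nonTrivial; euclidsLemma)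
open import Data.Nat.Primality.Factorisation using (factorise)
open import Data.Nat.Properties
open import Data.Product using (∃-syntax; _×_; _,_; proj₁; proj₂; swap)
open import Data.Sum using (inj₁; inj₂; reduce)
open import Function using (_∘_; _⇔_; mk⇔; Equivalence)
open import Level using (Level)
open import Relation.Binary.PropositionalEquality
  using (_≡_; _≢_; refl; sym; trans; cong; cong₂; subst; module ≡-Reasoning)
open import Relation.Nullary using (¬_; Dec; yes; no; does; _because_)
open import Relation.Nullary.Decidable
  using (⌊_⌋; T?; ¬?; _×-dec_; dec-true; dec-false; does-⇔; toWitness; fromWitness; toSum)
open import Relation.Unary using (Pred; Decidable)

open import Defs

private variable
  a : Level
  A B : Set a
  P Q : Set a

length-cong-unique : {xs ys : List A} → Unique xs → Unique ys →
                     (∀ {z} → z ∈ xs ⇔ z ∈ ys) → length xs ≡ length ys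
length-cong-unique xs! ys! xs⇔ys = ↭-length (∼bag⇒↭ (unique∧set⇒bag xs! ys! xs⇔ys))

Unique-concatMap : (key : B → A) {f : A → List B} {ks : List A} → Unique ks →
                   (∀ k → Unique (f k)) → (∀ {k y} → y ∈ f k → key y ≡ k) →
                   Unique (concatMap f ks)
Unique-concatMap key {ks = []} _ _ _ = []
Unique-concatMap key {f} {k ∷ ks} (k∉ks ∷ ks!) f! keyed =
  Unique.++⁺ (f! k) (Unique-concatMap key ks! f! keyed) disjoint
  where
  disjoint : ∀ {y} → y ∈ f k × y ∈ concatMap f ks → ⊥
  disjoint (y∈fk , y∈rest) with find (∈-concatMap⁻ f {xs = ks} y∈rest)
  ... | k′ , k′∈ks , y∈fk′ = All.lookup k∉ks k′∈ks (trans (sym (keyed y∈fk)) (keyed y∈fk′))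

length-filter-complement : {P : Pred A a} (P? : Decidable P) (xs : List A) →
  length (filter P? xs) ℕ.+ length (filter (¬? ∘ P?) xs) ≡ length xs
length-filter-complement P? []       = refl
length-filter-complement P? (x ∷ xs) with P? x
... | yes _ = cong suc (length-filter-complement P? xs)
... | no  _ = trans (+-suc _ _) (cong suc (length-filter-complement P? xs))

∈-range⁻ : ∀ {m n x} → x ∈ range m n → m ≤ x × x ≤ n
∈-range⁻ {m} {n} x∈ with ∈-map⁻ (m ℕ.+_) x∈
... | i , i∈ , refl =
  m≤m+n m i , ≮⇒≥ (λ n<m+i → <⇒≱ (∈-upTo⁻ i∈) (m≤n+o⇒m∸n≤o (suc n) m n<m+i))

∈-range⁺ : ∀ {m n x} → m ≤ x → x ≤ n → x ∈ range m n
∈-range⁺ {m} {n} {x} m≤x x≤n =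
  subst (_∈ range m n) (m+[n∸m]≡n m≤x) (∈-map⁺ (m ℕ.+_) (∈-upTo⁺ (∸-monoˡ-< (s≤s x≤n) m≤x)))

Unique-range : ∀ m n → Unique (range m n)
Unique-range m n = Unique.map⁺ (+-cancelˡ-≡ m _ _) (Unique.upTo⁺ _)

-- Indicators and finite sums

module _ where
  open import Data.Integer using (_+_; _*_)
  open ≡-Reasoning

  𝟙 : Dec P → ℤ
  𝟙 P? = if does P? then + 1 else + 0

  𝟙-yes : (P? : Dec P) → P → 𝟙 P? ≡ + 1
  𝟙-yes P? p rewrite dec-true P? p = refl

  𝟙-no : (P? : Dec P) → ¬ P → 𝟙 P? ≡ + 0
  𝟙-no P? ¬p rewrite dec-false P? ¬p = refl

  𝟙-cong : P ⇔ Q → (P? : Dec P) (Q? : Dec Q) → 𝟙 P? ≡ 𝟙 Q?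
  𝟙-cong P⇔Q P? Q? = cong (if_then + 1 else + 0) (does-⇔ P⇔Q P? Q?)

  𝟙-×-dec : (P? : Dec P) (Q? : Dec Q) → 𝟙 (P? ×-dec Q?) ≡ 𝟙 P? * 𝟙 Q?
  𝟙-×-dec (true  because _) (true  because _) = refl
  𝟙-×-dec (true  because _) (false because _) = refl
  𝟙-×-dec (false because _) Q?                = sym (ℤ.*-zeroˡ (𝟙 Q?))

  𝟙-*-cong : (P? : Dec P) {x y : ℤ} → (P → x ≡ y) → 𝟙 P? * x ≡ 𝟙 P? * y
  𝟙-*-cong (yes p) x≡y = cong (+ 1 *_) (x≡y p)
  𝟙-*-cong (no  _) _   = refl

  𝟙-split : (P? : Dec P) (x : ℤ) → x ≡ 𝟙 (¬? P?) * x + 𝟙 P? * x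
  𝟙-split (yes _) x = sym (trans (ℤ.+-identityˡ (+ 1 * x)) (ℤ.*-identityˡ x))
  𝟙-split (no  _) x = sym (trans (ℤ.+-identityʳ (+ 1 * x)) (ℤ.*-identityˡ x))

  -- Sums start at index 0; throughout, an index i stands for the positive integer i + 1.
  ∑< : ℕ → (ℕ → ℤ) → ℤ
  ∑< zero    f = + 0
  ∑< (suc n) f = ∑< n f + f n

  syntax ∑< n (λ i → x) = ∑[ i < n ] x

  ∑-cong : ∀ n {f g : ℕ → ℤ} → (∀ i → i < n → f i ≡ g i) → ∑< n f ≡ ∑< n g
  ∑-cong zero    f≡g = refl
  ∑-cong (suc n) f≡g = cong₂ _+_ (∑-cong n (λ i i<n → f≡g i (m<n⇒m<1+n i<n))) (f≡g n ≤-refl)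

  ∑-zero : ∀ n {f : ℕ → ℤ} → (∀ i → i < n → f i ≡ + 0) → ∑< n f ≡ + 0
  ∑-zero zero    f≡0 = refl
  ∑-zero (suc n) f≡0 = cong₂ _+_ (∑-zero n (λ i i<n → f≡0 i (m<n⇒m<1+n i<n))) (f≡0 n ≤-refl)

  ∑-const : ∀ n → ∑[ i < n ] (+ 1) ≡ + n
  ∑-const zero    = refl
  ∑-const (suc n) = trans (cong (_+ + 1) (∑-const n)) (cong +_ (+-comm n 1))

  ∑-distrib-+ : ∀ n (f g : ℕ → ℤ) → ∑[ i < n ] (f i + g i) ≡ ∑< n f + ∑< n g
  ∑-distrib-+ zero    f g = refl
  ∑-distrib-+ (suc n) f g = trans (cong (_+ (f n + g n)) (∑-distrib-+ n f g))
                                  (+-interchange (∑< n f) (∑< n g) (f n) (g n))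
    where
    +-interchange : ∀ w x y z → (w + x) + (y + z) ≡ (w + y) + (x + z)
    +-interchange = solve-∀

  ∑-distribˡ-* : ∀ n c (f : ℕ → ℤ) → ∑[ i < n ] (c * f i) ≡ c * ∑< n f
  ∑-distribˡ-* zero    c f = sym (ℤ.*-zeroʳ c)
  ∑-distribˡ-* (suc n) c f = trans (cong (_+ c * f n) (∑-distribˡ-* n c f))
                                   (sym (ℤ.*-distribˡ-+ c (∑< n f) (f n)))

  ∑-product : ∀ m n (f g : ℕ → ℤ) → ∑[ i < m ] ∑[ j < n ] (f i * g j) ≡ ∑< m f * ∑< n g
  ∑-product m n f g = begin
    ∑[ i < m ] ∑[ j < n ] (f i * g j)  ≡⟨ ∑-cong m (λ i _ → ∑-distribˡ-* n (f i) g) ⟩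
    ∑[ i < m ] (f i * ∑< n g)          ≡⟨ ∑-cong m (λ i _ → ℤ.*-comm (f i) (∑< n g)) ⟩
    ∑[ i < m ] (∑< n g * f i)          ≡⟨ ∑-distribˡ-* m (∑< n g) f ⟩
    ∑< n g * ∑< m f                    ≡⟨ ℤ.*-comm (∑< n g) (∑< m f) ⟩
    ∑< m f * ∑< n g                    ∎

  ∑-comm : ∀ m n (f : ℕ → ℕ → ℤ) → ∑[ i < m ] ∑[ j < n ] f i j ≡ ∑[ j < n ] ∑[ i < m ] f i j
  ∑-comm zero    n f = sym (∑-zero n (λ _ _ → refl))
  ∑-comm (suc m) n f = trans (cong (_+ ∑< n (f m)) (∑-comm m n f))
                             (sym (∑-distrib-+ n (λ j → ∑[ i < m ] f i j) (f m)))

  ∑-suc : ∀ n (f : ℕ → ℤ) → ∑< (suc n) f ≡ f 0 + ∑[ i < n ] f (suc i)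
  ∑-suc zero    f = trans (ℤ.+-identityˡ (f 0)) (sym (ℤ.+-identityʳ (f 0)))
  ∑-suc (suc n) f = trans (cong (_+ f (suc n)) (∑-suc n f)) (ℤ.+-assoc (f 0) _ _)

  ∑-+ : ∀ m n (f : ℕ → ℤ) → ∑< (m ℕ.+ n) f ≡ ∑< m f + ∑[ i < n ] f (m ℕ.+ i)
  ∑-+ m zero    f = trans (cong (λ k → ∑< k f) (+-identityʳ m)) (sym (ℤ.+-identityʳ (∑< m f)))
  ∑-+ m (suc n) f = trans (cong (λ k → ∑< k f) (+-suc m n))
                          (trans (cong (_+ f (m ℕ.+ n)) (∑-+ m n f)) (ℤ.+-assoc (∑< m f) _ _))

  ∑-vanishing-from : ∀ m n (f : ℕ → ℤ) → (∀ i → m ≤ i → i < n → f i ≡ + 0) → m ≤ n →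
                     ∑< n f ≡ ∑< m f
  ∑-vanishing-from m n f f≡0 m≤n = begin
    ∑< n f                               ≡⟨ cong (λ k → ∑< k f) (sym (m+[n∸m]≡n m≤n)) ⟩
    ∑< (m ℕ.+ (n ∸ m)) f                  ≡⟨ ∑-+ m (n ∸ m) f ⟩
    ∑< m f + ∑[ i < n ∸ m ] f (m ℕ.+ i)   ≡⟨ cong (λ s → ∑< m f + s) (∑-zero (n ∸ m) tail≡0) ⟩
    ∑< m f + + 0                          ≡⟨ ℤ.+-identityʳ (∑< m f) ⟩
    ∑< m f                                ∎
    where
    tail≡0 : ∀ i → i < n ∸ m → f (m ℕ.+ i) ≡ + 0
    tail≡0 i i<n∸m = f≡0 (m ℕ.+ i) (m≤m+n m i) (subst (m ℕ.+ i <_) (m+[n∸m]≡n m≤n) (+-monoʳ-< m i<n∸m))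

  sumℤ-++ : ∀ xs ys → sumℤ (xs ++ ys) ≡ sumℤ xs + sumℤ ys
  sumℤ-++ []       ys = sym (ℤ.+-identityˡ (sumℤ ys))
  sumℤ-++ (x ∷ xs) ys = trans (cong (_+_ x) (sumℤ-++ xs ys)) (sym (ℤ.+-assoc x (sumℤ xs) (sumℤ ys)))

  sumℤ-applyUpTo : ∀ n (f : ℕ → ℤ) → sumℤ (applyUpTo f n) ≡ ∑< n f
  sumℤ-applyUpTo zero    f = refl
  sumℤ-applyUpTo (suc n) f = trans (cong (_+_ (f 0)) (sumℤ-applyUpTo n (f ∘ suc))) (sym (∑-suc n f))

  sumℤ-upTo : ∀ n (f : ℕ → ℤ) → sumℤ (map f (upTo n)) ≡ ∑< n f
  sumℤ-upTo n f = trans (cong sumℤ (map-applyUpTo (λ i → i) f n)) (sumℤ-applyUpTo n f)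

  sumℤ-range1 : ∀ n (f : ℕ → ℤ) → sumℤ (map f (range 1 n)) ≡ ∑[ i < n ] f (suc i)
  sumℤ-range1 n f = trans (cong sumℤ (sym (map-∘ (upTo n)))) (sumℤ-upTo n (f ∘ suc))

  sumℤ-cartesianProduct : ∀ (f : A × B → ℤ) xs ys →
    sumℤ (map f (cartesianProduct xs ys)) ≡ sumℤ (map (λ x → sumℤ (map (λ y → f (x , y)) ys)) xs)
  sumℤ-cartesianProduct f []       ys = refl
  sumℤ-cartesianProduct f (x ∷ xs) ys = begin
    sumℤ (map f (map (x ,_) ys ++ cartesianProduct xs ys))
      ≡⟨ cong sumℤ (map-++ f (map (x ,_) ys) (cartesianProduct xs ys)) ⟩
    sumℤ (map f (map (x ,_) ys) ++ map f (cartesianProduct xs ys))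
      ≡⟨ sumℤ-++ (map f (map (x ,_) ys)) _ ⟩
    sumℤ (map f (map (x ,_) ys)) + sumℤ (map f (cartesianProduct xs ys))
      ≡⟨ cong₂ _+_ (cong sumℤ (sym (map-∘ ys))) (sumℤ-cartesianProduct f xs ys) ⟩
    sumℤ (map (λ y → f (x , y)) ys) + sumℤ (map (λ x → sumℤ (map (λ y → f (x , y)) ys)) xs) ∎

  length-filter≡sumℤ-𝟙 : {P : Pred A a} (P? : Decidable P) (xs : List A) →
                         + length (filter P? xs) ≡ sumℤ (map (𝟙 ∘ P?) xs)
  length-filter≡sumℤ-𝟙 P? []       = refl
  length-filter≡sumℤ-𝟙 P? (x ∷ xs) with P? x
  ... | yes _ = trans (ℤ.pos-+ 1 _) (cong (_+_ (+ 1)) (length-filter≡sumℤ-𝟙 P? xs))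
  ... | no  _ = trans (length-filter≡sumℤ-𝟙 P? xs) (sym (ℤ.+-identityˡ _))

-- Counting multiples

¬∣-between-multiples : ∀ {c} k i .{{_ : NonZero c}} → suc i < c → ¬ c ∣ suc (c ℕ.* k ℕ.+ i)
¬∣-between-multiples {c} k i i+1<c c∣ =
  <⇒≱ i+1<c (∣⇒≤ (∣m+n∣m⇒∣n (subst (c ∣_) (sym (+-suc (c ℕ.* k) i)) c∣) (m∣m*n k)))

module _ where
  open import Data.Integer using (_+_; _*_)
  open ≡-Reasoning

  ∑-multiples : ∀ c .{{_ : NonZero c}} k (F : ℕ → ℤ) →
    ∑[ d < c ℕ.* k ] (𝟙 (c ∣? suc d) * F (suc d)) ≡ ∑[ e < k ] F (c ℕ.* suc e)
  ∑-multiples c zero F = cong (λ n → ∑< n (λ d → 𝟙 (c ∣? suc d) * F (suc d))) (*-zeroʳ c)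
  ∑-multiples (suc c) (suc k) F = begin
    ∑< (p ℕ.* suc k) f                                ≡⟨ cong (λ n → ∑< n f) (sym pk+p≡p[k+1]) ⟩
    ∑< (p ℕ.* k ℕ.+ p) f                               ≡⟨ ∑-+ (p ℕ.* k) p f ⟩
    ∑< (p ℕ.* k) f + ∑[ i < p ] f (p ℕ.* k ℕ.+ i)      ≡⟨ cong₂ _+_ (∑-multiples p k F) last-block ⟩
    ∑[ e < k ] F (p ℕ.* suc e) + F (p ℕ.* suc k)       ∎
    where
    p : ℕ
    p = suc c
    f : ℕ → ℤ
    f d = 𝟙 (p ∣? suc d) * F (suc d)
    pk+p≡p[k+1] : p ℕ.* k ℕ.+ p ≡ p ℕ.* suc k
    pk+p≡p[k+1] = trans (+-comm (p ℕ.* k) p) (sym (*-suc p k))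
    top : suc (p ℕ.* k ℕ.+ c) ≡ p ℕ.* suc k
    top = trans (sym (+-suc (p ℕ.* k) c)) pk+p≡p[k+1]
    between : ∀ i → i < c → f (p ℕ.* k ℕ.+ i) ≡ + 0
    between i i<c = trans (cong (_* F (suc (p ℕ.* k ℕ.+ i)))
                                (𝟙-no (p ∣? suc (p ℕ.* k ℕ.+ i)) (¬∣-between-multiples k i (s≤s i<c))))
                          (ℤ.*-zeroˡ (F (suc (p ℕ.* k ℕ.+ i))))
    last-block : ∑[ i < p ] f (p ℕ.* k ℕ.+ i) ≡ F (p ℕ.* suc k)
    last-block = begin
      ∑[ i < c ] f (p ℕ.* k ℕ.+ i) + f (p ℕ.* k ℕ.+ c)
        ≡⟨ cong₂ _+_ (∑-zero c between)
                     (cong₂ _*_ (𝟙-yes (p ∣? suc (p ℕ.* k ℕ.+ c)) (subst (p ∣_) (sym top) (m∣m*n (suc k))))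
                                (cong F top)) ⟩
      + 0 + + 1 * F (p ℕ.* suc k)
        ≡⟨ trans (ℤ.+-identityˡ _) (ℤ.*-identityˡ _) ⟩
      F (p ℕ.* suc k) ∎

  ∑-𝟙-∣≡/ : ∀ c .{{_ : NonZero c}} n → ∑[ i < n ] 𝟙 (c ∣? suc i) ≡ + (n / c)
  ∑-𝟙-∣≡/ c n = begin
    ∑< n f                                          ≡⟨ cong (λ m → ∑< m f) n≡ck+r ⟩
    ∑< (c ℕ.* k ℕ.+ r) f                             ≡⟨ ∑-+ (c ℕ.* k) r f ⟩
    ∑< (c ℕ.* k) f + ∑[ i < r ] f (c ℕ.* k ℕ.+ i)    ≡⟨ cong₂ _+_ multiples remainder ⟩
    + k + + 0                                       ≡⟨ ℤ.+-identityʳ (+ k) ⟩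
    + k                                             ∎
    where
    f : ℕ → ℤ
    f i = 𝟙 (c ∣? suc i)
    k r : ℕ
    k = n / c
    r = n % c
    n≡ck+r : n ≡ c ℕ.* k ℕ.+ r
    n≡ck+r = trans (m≡m%n+[m/n]*n n c) (trans (+-comm r (k ℕ.* c)) (cong (ℕ._+ r) (*-comm k c)))
    multiples : ∑< (c ℕ.* k) f ≡ + k
    multiples = begin
      ∑< (c ℕ.* k) f                  ≡⟨ ∑-cong (c ℕ.* k) (λ i _ → sym (ℤ.*-identityʳ (f i))) ⟩
      ∑[ i < c ℕ.* k ] (f i * + 1)    ≡⟨ ∑-multiples c k (λ _ → + 1) ⟩
      ∑[ e < k ] (+ 1)                ≡⟨ ∑-const k ⟩
      + k                             ∎
    remainder : ∑[ i < r ] f (c ℕ.* k ℕ.+ i) ≡ + 0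
    remainder = ∑-zero r (λ i i<r → 𝟙-no (c ∣? suc (c ℕ.* k ℕ.+ i))
                                         (¬∣-between-multiples k i (<-≤-trans (s≤s i<r) (m%n<n n c))))

-- The Möbius function

module _ where
  open import Data.Nat using (_*_)

  prime∤⇒coprime : ∀ {p n} → Prime p → ¬ p ∣ n → Coprime p n
  prime∤⇒coprime p-prime p∤n (d∣p , d∣n) with prime⇒irreducible p-prime d∣p
  ... | inj₁ d≡1  = d≡1
  ... | inj₂ refl = ⊥-elim (p∤n d∣n)

  prime∣prime⇒≡ : ∀ {p q} → Prime p → Prime q → p ∣ q → p ≡ q
  prime∣prime⇒≡ p-prime q-prime p∣q with prime⇒irreducible q-prime p∣q
  ... | inj₁ refl = ⊥-elim (¬prime[1] p-prime)
  ... | inj₂ p≡q  = p≡q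

  ∃-prime-divisor : ∀ {n} → 1 < n → ∃[ p ] Prime p × p ∣ n
  ∃-prime-divisor {suc n} 1<n with factorise (suc n)
  ... | record { factors = [] ; isFactorisation = n≡1 } = ⊥-elim (<-irrefl (sym n≡1) 1<n)
  ... | record { factors = p ∷ ps ; isFactorisation = n≡p*ps ; factorsPrime = p-prime ∷ _ } =
    p , p-prime , subst (p ∣_) (sym n≡p*ps) (m∣m*n (product ps))

  ∈-primeDivisors⁻ : ∀ {n p} → p ∈ primeDivisors n → Prime p × p ∣ n
  ∈-primeDivisors⁻ {n} p∈ = proj₂ (∈-filter⁻ (λ p → prime? p ×-dec (p ∣? n)) {xs = range 2 n} p∈)

  ∈-primeDivisors⁺ : ∀ {n p} .{{_ : NonZero n}} → Prime p → p ∣ n → p ∈ primeDivisors n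
  ∈-primeDivisors⁺ {n} p-prime p∣n =
    ∈-filter⁺ (λ p → prime? p ×-dec (p ∣? n))
      (∈-range⁺ (nonTrivial⇒n>1 _ {{prime⇒nonTrivial p-prime}}) (∣⇒≤ p∣n)) (p-prime , p∣n)

  Unique-primeDivisors : ∀ n → Unique (primeDivisors n)
  Unique-primeDivisors n = Unique.filter⁺ (λ p → prime? p ×-dec (p ∣? n)) (Unique-range 2 n)

  squareful⇔ : ∀ {n} .{{_ : NonZero n}} → T (squareful n) ⇔ (∃[ p ] Prime p × p * p ∣ n)
  squareful⇔ {n} = mk⇔ to from
    where
    square∣? : ℕ → Bool
    square∣? p = ⌊ p * p ∣? n ⌋
    to : T (squareful n) → ∃[ p ] Prime p × p * p ∣ n
    to sq with find (any⁻ square∣? (primeDivisors n) sq)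
    ... | p , p∈ , pp∣n = p , proj₁ (∈-primeDivisors⁻ {n} p∈) , toWitness pp∣n
    from : ∃[ p ] Prime p × p * p ∣ n → T (squareful n)
    from (p , p-prime , pp∣n) =
      any⁺ square∣? (lose (∈-primeDivisors⁺ p-prime (∣-trans (m∣m*n p) pp∣n)) (fromWitness pp∣n))

  module _ {p n : ℕ} (p-prime : Prime p) .{{_ : NonZero n}} where
    private instance
      p*n≢0 : NonZero (p * n)
      p*n≢0 = m*n≢0 p n {{prime⇒nonZero p-prime}}

    μ[p*n]≡0 : p ∣ n → μ (p * n) ≡ + 0
    μ[p*n]≡0 p∣n rewrite
      Equivalence.to T-≡ (Equivalence.from (squareful⇔ {p * n}) (p , p-prime , *-monoʳ-∣ p p∣n)) = refl

    module _ (p∤n : ¬ p ∣ n) where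

      squareful[p*n]≡squareful[n] : squareful (p * n) ≡ squareful n
      squareful[p*n]≡squareful[n] = does-⇔ (mk⇔ to from) (T? (squareful (p * n))) (T? (squareful n))
        where
        to : T (squareful (p * n)) → T (squareful n)
        to sq with Equivalence.to (squareful⇔ {p * n}) sq
        ... | q , q-prime , qq∣pn with p ∣? q * q
        ... | yes p∣qq = ⊥-elim (p∤n (*-cancelˡ-∣ p {{prime⇒nonZero p-prime}} pp∣pn))
          where
          p≡q : p ≡ q
          p≡q = prime∣prime⇒≡ p-prime q-prime (reduce (euclidsLemma q q p-prime p∣qq))
          pp∣pn : p * p ∣ p * n
          pp∣pn = subst (λ r → r * r ∣ p * n) (sym p≡q) qq∣pn
        ... | no p∤qq = Equivalence.from squareful⇔
                          (q , q-prime , coprime-divisor (Coprime.sym (prime∤⇒coprime p-prime p∤qq)) qq∣pn)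
        from : T (squareful n) → T (squareful (p * n))
        from sq with Equivalence.to squareful⇔ sq
        ... | q , q-prime , qq∣n = Equivalence.from (squareful⇔ {p * n}) (q , q-prime , ∣n⇒∣m*n p qq∣n)

      length-primeDivisors[p*n] : length (primeDivisors (p * n)) ≡ suc (length (primeDivisors n))
      length-primeDivisors[p*n] =
        length-cong-unique (Unique-primeDivisors (p * n)) (p∉ ∷ Unique-primeDivisors n) (mk⇔ to from)
        where
        p∉ : All (p ≢_) (primeDivisors n)
        p∉ = All.tabulate (λ { q∈ refl → p∤n (proj₂ (∈-primeDivisors⁻ {n} q∈)) })
        to : ∀ {q} → q ∈ primeDivisors (p * n) → q ∈ p ∷ primeDivisors n
        to q∈ with ∈-primeDivisors⁻ {p * n} q∈
        ... | q-prime , q∣pn with euclidsLemma p n q-prime q∣pn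
        ... | inj₁ q∣p = here (prime∣prime⇒≡ q-prime p-prime q∣p)
        ... | inj₂ q∣n = there (∈-primeDivisors⁺ q-prime q∣n)
        from : ∀ {q} → q ∈ p ∷ primeDivisors n → q ∈ primeDivisors (p * n)
        from (here refl) = ∈-primeDivisors⁺ p-prime (m∣m*n n)
        from (there q∈) with ∈-primeDivisors⁻ {n} q∈
        ... | q-prime , q∣n = ∈-primeDivisors⁺ q-prime (∣n⇒∣m*n p q∣n)

      μ[p*n]≡-μ[n] : μ (p * n) ≡ - μ n
      μ[p*n]≡-μ[n] rewrite squareful[p*n]≡squareful[n] | length-primeDivisors[p*n] with squareful n
      ... | true  = refl
      ... | false = refl

module _ where
  open import Data.Integer using (_+_; _*_)
  open ≡-Reasoning

  module _ {p : ℕ} (p-prime : Prime p) (k : ℕ) where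
    private instance
      p≢0 : NonZero p
      p≢0 = prime⇒nonZero p-prime

    𝟙-∣p*k : ∀ {d} → ¬ p ∣ d → 𝟙 (d ∣? p ℕ.* k) ≡ 𝟙 (d ∣? k)
    𝟙-∣p*k {d} p∤d = 𝟙-cong (mk⇔ d∣pk⇒d∣k (∣n⇒∣m*n p)) (d ∣? p ℕ.* k) (d ∣? k)
      where
      d∣pk⇒d∣k : d ∣ p ℕ.* k → d ∣ k
      d∣pk⇒d∣k = coprime-divisor (Coprime.sym (prime∤⇒coprime p-prime p∤d))

    -- The divisor e of k (p ∤ e) and the divisor p e of p k contribute opposite amounts.
    μ-pair-cancels : ∀ e .{{_ : NonZero e}} →
      𝟙 (¬? (p ∣? e)) * (μ e * 𝟙 (e ∣? k)) + μ (p ℕ.* e) * 𝟙 (p ℕ.* e ∣? p ℕ.* k) ≡ + 0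
    μ-pair-cancels e with toSum (p ∣? e)
    ... | inj₁ p∣e = cong₂ (λ x y → x * (μ e * 𝟙 (e ∣? k)) + y * 𝟙 (p ℕ.* e ∣? p ℕ.* k))
                           (𝟙-no (¬? (p ∣? e)) (λ p∤e → p∤e p∣e)) (μ[p*n]≡0 p-prime p∣e)
    ... | inj₂ p∤e = begin
      𝟙 (¬? (p ∣? e)) * (μ e * 𝟙 (e ∣? k)) + μ (p ℕ.* e) * 𝟙 (p ℕ.* e ∣? p ℕ.* k)
        ≡⟨ cong₂ (λ x y → x * (μ e * 𝟙 (e ∣? k)) + y)
                 (𝟙-yes (¬? (p ∣? e)) p∤e)
                 (cong₂ _*_ (μ[p*n]≡-μ[n] p-prime p∤e)
                            (𝟙-cong pe∣pk⇔e∣k (p ℕ.* e ∣? p ℕ.* k) (e ∣? k))) ⟩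
      + 1 * (μ e * 𝟙 (e ∣? k)) + - μ e * 𝟙 (e ∣? k)
        ≡⟨ 1*[x*y]+-x*y≡0 (μ e) (𝟙 (e ∣? k)) ⟩
      + 0 ∎
      where
      pe∣pk⇔e∣k : (p ℕ.* e ∣ p ℕ.* k) ⇔ (e ∣ k)
      pe∣pk⇔e∣k = mk⇔ (*-cancelˡ-∣ p) (*-monoʳ-∣ p)
      1*[x*y]+-x*y≡0 : ∀ x y → + 1 * (x * y) + - x * y ≡ + 0
      1*[x*y]+-x*y≡0 = solve-∀

    ∑-μ-∣[p*k]≡0 : .{{_ : NonZero k}} → ∑[ d < p ℕ.* k ] (μ (suc d) * 𝟙 (suc d ∣? p ℕ.* k)) ≡ + 0
    ∑-μ-∣[p*k]≡0 = begin
      ∑< g f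
        ≡⟨ ∑-cong g (λ d _ → 𝟙-split (p ∣? suc d) (f d)) ⟩
      ∑[ d < g ] (𝟙 (¬? (p ∣? suc d)) * f d + 𝟙 (p ∣? suc d) * f d)
        ≡⟨ ∑-distrib-+ g (λ d → 𝟙 (¬? (p ∣? suc d)) * f d) (λ d → 𝟙 (p ∣? suc d) * f d) ⟩
      ∑[ d < g ] (𝟙 (¬? (p ∣? suc d)) * f d) + ∑[ d < g ] (𝟙 (p ∣? suc d) * f d)
        ≡⟨ cong₂ _+_ coprime-part (∑-multiples p k (λ x → μ x * 𝟙 (x ∣? g))) ⟩
      ∑< k u + ∑< k v
        ≡⟨ sym (∑-distrib-+ k u v) ⟩
      ∑[ e < k ] (u e + v e)
        ≡⟨ ∑-zero k (λ e _ → μ-pair-cancels (suc e)) ⟩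
      + 0 ∎
      where
      g : ℕ
      g = p ℕ.* k
      f u v : ℕ → ℤ
      f d = μ (suc d) * 𝟙 (suc d ∣? g)
      u e = 𝟙 (¬? (p ∣? suc e)) * (μ (suc e) * 𝟙 (suc e ∣? k))
      v e = μ (p ℕ.* suc e) * 𝟙 (p ℕ.* suc e ∣? g)
      beyond-k : ∀ i → k ≤ i → i < g → u i ≡ + 0
      beyond-k i k≤i _ = begin
        u i
          ≡⟨ cong (λ x → 𝟙 (¬? (p ∣? suc i)) * (μ (suc i) * x)) (𝟙-no (suc i ∣? k) i+1∤k) ⟩
        𝟙 (¬? (p ∣? suc i)) * (μ (suc i) * + 0)
          ≡⟨ cong (𝟙 (¬? (p ∣? suc i)) *_) (ℤ.*-zeroʳ (μ (suc i))) ⟩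
        𝟙 (¬? (p ∣? suc i)) * + 0
          ≡⟨ ℤ.*-zeroʳ (𝟙 (¬? (p ∣? suc i))) ⟩
        + 0 ∎
        where
        i+1∤k : ¬ suc i ∣ k
        i+1∤k i+1∣k = <⇒≱ (s≤s k≤i) (∣⇒≤ i+1∣k)
      coprime-part : ∑[ d < g ] (𝟙 (¬? (p ∣? suc d)) * f d) ≡ ∑< k u
      coprime-part = trans (∑-cong g (λ d _ → 𝟙-*-cong (¬? (p ∣? suc d)) (cong (μ (suc d) *_) ∘ 𝟙-∣p*k)))
                           (∑-vanishing-from k g u beyond-k (m≤n*m k p))

  ∑-μ-∣-up-to-self : ∀ g → 1 ≤ g → ∑[ d < g ] (μ (suc d) * 𝟙 (suc d ∣? g)) ≡ 𝟙 (g ≟ 1)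
  ∑-μ-∣-up-to-self (suc zero)    _ = refl
  ∑-μ-∣-up-to-self (suc (suc n)) _ with ∃-prime-divisor {suc (suc n)} (s≤s (s≤s z≤n))
  ... | p , p-prime , p∣g =
    subst (λ g → ∑[ d < g ] (μ (suc d) * 𝟙 (suc d ∣? g)) ≡ + 0) (sym (m∣n⇒n≡m*quotient p∣g))
          (∑-μ-∣[p*k]≡0 p-prime (quotient p∣g) {{quotient≢0 p∣g}})

  ∑-μ-∣ : ∀ g N → 1 ≤ g → g ≤ N → ∑[ d < N ] (μ (suc d) * 𝟙 (suc d ∣? g)) ≡ 𝟙 (g ≟ 1)
  ∑-μ-∣ g N 1≤g g≤N = trans (∑-vanishing-from g N (λ d → μ (suc d) * 𝟙 (suc d ∣? g)) beyond-g g≤N)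
                            (∑-μ-∣-up-to-self g 1≤g)
    where
    beyond-g : ∀ i → g ≤ i → i < N → μ (suc i) * 𝟙 (suc i ∣? g) ≡ + 0
    beyond-g i g≤i _ = trans (cong (μ (suc i) *_) (𝟙-no (suc i ∣? g) i+1∤g)) (ℤ.*-zeroʳ (μ (suc i)))
      where
      i+1∤g : ¬ suc i ∣ g
      i+1∤g i+1∣g = <⇒≱ (s≤s g≤i) (∣⇒≤ {{>-nonZero 1≤g}} i+1∣g)

-- Coprime pairs

coprime? : Decidable (λ (x : Frac) → gcd (proj₁ x) (proj₂ x) ≡ 1)
coprime? x = gcd (proj₁ x) (proj₂ x) ≟ 1

coprimePairs : ℕ → ℕ → List Frac
coprimePairs m n = filter coprime? (cartesianProduct (range 1 m) (range 1 n))

Unique-coprimePairs : ∀ m n → Unique (coprimePairs m n)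
Unique-coprimePairs m n = Unique.filter⁺ coprime? (Unique.cartesianProduct⁺ (Unique-range 1 m) (Unique-range 1 n))

∈-coprimePairs⁻ : ∀ {m n h j} → (h , j) ∈ coprimePairs m n →
                  (1 ≤ h × h ≤ m) × (1 ≤ j × j ≤ n) × gcd h j ≡ 1
∈-coprimePairs⁻ {m} {n} x∈ with ∈-filter⁻ coprime? {xs = cartesianProduct (range 1 m) (range 1 n)} x∈
... | x∈′ , coprime with ∈-cartesianProduct⁻ (range 1 m) (range 1 n) x∈′
... | h∈ , j∈ = ∈-range⁻ h∈ , ∈-range⁻ j∈ , coprime

∈-coprimePairs⁺ : ∀ {m n h j} → 1 ≤ h → h ≤ m → 1 ≤ j → j ≤ n → gcd h j ≡ 1 →
                  (h , j) ∈ coprimePairs m n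
∈-coprimePairs⁺ 1≤h h≤m 1≤j j≤n coprime =
  ∈-filter⁺ coprime? (∈-cartesianProduct⁺ (∈-range⁺ 1≤h h≤m) (∈-range⁺ 1≤j j≤n)) coprime

∣gcd⇔ : ∀ {d m n} → d ∣ gcd m n ⇔ (d ∣ m × d ∣ n)
∣gcd⇔ {d} {m} {n} = mk⇔ (λ d∣g → ∣-trans d∣g (gcd[m,n]∣m m n) , ∣-trans d∣g (gcd[m,n]∣n m n))
                        (λ (d∣m , d∣n) → gcd-greatest d∣m d∣n)

module _ where
  open import Data.Integer using (_+_; _*_)
  open ≡-Reasoning

  length-coprimePairs≡∑∑ : ∀ m n →
    + length (coprimePairs m n) ≡ ∑[ i < m ] ∑[ j < n ] 𝟙 (gcd (suc i) (suc j) ≟ 1)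
  length-coprimePairs≡∑∑ m n = begin
    + length (coprimePairs m n)
      ≡⟨ length-filter≡sumℤ-𝟙 coprime? (cartesianProduct (range 1 m) (range 1 n)) ⟩
    sumℤ (map (𝟙 ∘ coprime?) (cartesianProduct (range 1 m) (range 1 n)))
      ≡⟨ sumℤ-cartesianProduct (𝟙 ∘ coprime?) (range 1 m) (range 1 n) ⟩
    sumℤ (map (λ h → sumℤ (map (λ j → 𝟙 (gcd h j ≟ 1)) (range 1 n))) (range 1 m))
      ≡⟨ sumℤ-range1 m _ ⟩
    ∑[ i < m ] sumℤ (map (λ j → 𝟙 (gcd (suc i) j ≟ 1)) (range 1 n))
      ≡⟨ ∑-cong m (λ i _ → sumℤ-range1 n _) ⟩
    ∑[ i < m ] ∑[ j < n ] 𝟙 (gcd (suc i) (suc j) ≟ 1) ∎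

  𝟙-coprime≡∑μ : ∀ N i j → suc i ≤ N →
    𝟙 (gcd (suc i) (suc j) ≟ 1) ≡ ∑[ d < N ] (μ (suc d) * (𝟙 (suc d ∣? suc i) * 𝟙 (suc d ∣? suc j)))
  𝟙-coprime≡∑μ N i j i<N = begin
    𝟙 (g ≟ 1)
      ≡⟨ sym (∑-μ-∣ g N 1≤g (≤-trans g≤i+1 i<N)) ⟩
    ∑[ d < N ] (μ (suc d) * 𝟙 (suc d ∣? g))
      ≡⟨ ∑-cong N (λ d _ → cong (μ (suc d) *_) (𝟙-∣gcd d)) ⟩
    ∑[ d < N ] (μ (suc d) * (𝟙 (suc d ∣? suc i) * 𝟙 (suc d ∣? suc j))) ∎
    where
    g : ℕ
    g = gcd (suc i) (suc j)
    1≤g : 1 ≤ g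
    1≤g = n≢0⇒n>0 (gcd[m,n]≢0 (suc i) (suc j) (inj₁ λ ()))
    g≤i+1 : g ≤ suc i
    g≤i+1 = ∣⇒≤ (gcd[m,n]∣m (suc i) (suc j))
    𝟙-∣gcd : ∀ d → 𝟙 (suc d ∣? g) ≡ 𝟙 (suc d ∣? suc i) * 𝟙 (suc d ∣? suc j)
    𝟙-∣gcd d = trans (𝟙-cong ∣gcd⇔ (suc d ∣? g) ((suc d ∣? suc i) ×-dec (suc d ∣? suc j)))
                     (𝟙-×-dec (suc d ∣? suc i) (suc d ∣? suc j))

  ∑∑μ≡μ*⌊⌋*⌊⌋ : ∀ m n d →
    ∑[ i < m ] ∑[ j < n ] (μ (suc d) * (𝟙 (suc d ∣? suc i) * 𝟙 (suc d ∣? suc j)))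
      ≡ μ (suc d) * + ((m / suc d) ℕ.* (n / suc d))
  ∑∑μ≡μ*⌊⌋*⌊⌋ m n d = begin
    ∑[ i < m ] ∑[ j < n ] (μ (suc d) * (𝟙 (suc d ∣? suc i) * 𝟙 (suc d ∣? suc j)))
      ≡⟨ ∑-cong m (λ i _ → ∑-distribˡ-* n (μ (suc d)) _) ⟩
    ∑[ i < m ] (μ (suc d) * ∑[ j < n ] (𝟙 (suc d ∣? suc i) * 𝟙 (suc d ∣? suc j)))
      ≡⟨ ∑-distribˡ-* m (μ (suc d)) _ ⟩
    μ (suc d) * ∑[ i < m ] ∑[ j < n ] (𝟙 (suc d ∣? suc i) * 𝟙 (suc d ∣? suc j))
      ≡⟨ cong (μ (suc d) *_) (∑-product m n (λ i → 𝟙 (suc d ∣? suc i)) (λ j → 𝟙 (suc d ∣? suc j))) ⟩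
    μ (suc d) * (∑[ i < m ] 𝟙 (suc d ∣? suc i) * ∑[ j < n ] 𝟙 (suc d ∣? suc j))
      ≡⟨ cong (μ (suc d) *_) (cong₂ _*_ (∑-𝟙-∣≡/ (suc d) m) (∑-𝟙-∣≡/ (suc d) n)) ⟩
    μ (suc d) * (+ (m / suc d) * + (n / suc d))
      ≡⟨ cong (μ (suc d) *_) (sym (ℤ.pos-* (m / suc d) (n / suc d))) ⟩
    μ (suc d) * + ((m / suc d) ℕ.* (n / suc d)) ∎

  length-coprimePairs≡mobiusSum : ∀ m n → + length (coprimePairs m n) ≡ mobiusSum m n
  length-coprimePairs≡mobiusSum m n = begin
    + length (coprimePairs m n)
      ≡⟨ length-coprimePairs≡∑∑ m n ⟩
    ∑[ i < m ] ∑[ j < n ] 𝟙 (gcd (suc i) (suc j) ≟ 1)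
      ≡⟨ ∑-cong m (λ i i<m → ∑-cong n (λ j _ → 𝟙-coprime≡∑μ m i j i<m)) ⟩
    ∑[ i < m ] ∑[ j < n ] ∑[ d < m ] t d i j
      ≡⟨ ∑-cong m (λ i _ → ∑-comm n m (λ j d → t d i j)) ⟩
    ∑[ i < m ] ∑[ d < m ] ∑[ j < n ] t d i j
      ≡⟨ ∑-comm m m (λ i d → ∑[ j < n ] t d i j) ⟩
    ∑[ d < m ] ∑[ i < m ] ∑[ j < n ] t d i j
      ≡⟨ ∑-cong m (λ d _ → ∑∑μ≡μ*⌊⌋*⌊⌋ m n d) ⟩
    ∑[ d < m ] (μ (suc d) * + ((m / suc d) ℕ.* (n / suc d)))
      ≡⟨ sym (sumℤ-upTo m _) ⟩
    mobiusSum m n ∎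
    where
    t : ℕ → ℕ → ℕ → ℤ
    t d i j = μ (suc d) * (𝟙 (suc d ∣? suc i) * 𝟙 (suc d ∣? suc j))

-- Farey sequences

module _ where
  open import Data.Nat using (_+_)

  Unique-Farey : ∀ q → Unique (Farey q)
  Unique-Farey q = Unique.filter⁺ coprime? (Unique-concatMap proj₂ (Unique-range 1 q) column! column-keyed)
    where
    column : ℕ → List Frac
    column k = map (_, k) (range 0 k)
    column! : ∀ k → Unique (column k)
    column! k = Unique.map⁺ (cong proj₁) (Unique-range 0 k)
    column-keyed : ∀ {k x} → x ∈ column k → proj₂ x ≡ k
    column-keyed {k} x∈ with ∈-map⁻ (_, k) x∈
    ... | _ , _ , refl = refl

  ∈-Farey⁻ : ∀ {q h k} → (h , k) ∈ Farey q → (1 ≤ k × k ≤ q) × h ≤ k × gcd h k ≡ 1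
  ∈-Farey⁻ {q} x∈ with ∈-filter⁻ coprime? {xs = concatMap (λ k → map (_, k) (range 0 k)) (range 1 q)} x∈
  ... | x∈′ , coprime with find (∈-concatMap⁻ (λ k → map (_, k) (range 0 k)) {xs = range 1 q} x∈′)
  ... | k , k∈ , x∈column with ∈-map⁻ (_, k) x∈column
  ... | h , h∈ , refl = ∈-range⁻ k∈ , proj₂ (∈-range⁻ {0} h∈) , coprime

  ∈-Farey⁺ : ∀ {q h k} → 1 ≤ k → k ≤ q → h ≤ k → gcd h k ≡ 1 → (h , k) ∈ Farey q
  ∈-Farey⁺ {q} {h} {k} 1≤k k≤q h≤k coprime =
    ∈-filter⁺ coprime?
      (∈-concatMap⁺ (λ k → map (_, k) (range 0 k)) {xs = range 1 q}
        (lose (∈-range⁺ 1≤k k≤q) (∈-map⁺ (_, k) (∈-range⁺ z≤n h≤k))))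
      coprime

  FareyP-self : ∀ q → FareyP q q ≡ Farey q
  FareyP-self q = filter-all (λ x → proj₁ x ≤? q) (All.tabulate h≤q)
    where
    h≤q : ∀ {x} → x ∈ Farey q → proj₁ x ≤ q
    h≤q {h , k} x∈ with ∈-Farey⁻ {q} x∈
    ... | (_ , k≤q) , h≤k , _ = ≤-trans h≤k k≤q

  gcd[0,n]≡1⇒n≡1 : ∀ {n} → gcd 0 n ≡ 1 → n ≡ 1
  gcd[0,n]≡1⇒n≡1 {n} = trans (sym (gcd-identityˡ n))

  gcd[n,n]≡n : ∀ n → gcd n n ≡ n
  gcd[n,n]≡n n = ∣-antisym (gcd[m,n]∣m n n) (gcd-greatest ∣-refl ∣-refl)

  gcd[m,m+n]≡gcd[m,n] : ∀ m n → gcd m (m + n) ≡ gcd m n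
  gcd[m,m+n]≡gcd[m,n] m n = ∣-antisym
    (gcd-greatest (gcd[m,n]∣m m (m + n)) (∣m+n∣m⇒∣n (gcd[m,n]∣n m (m + n)) (gcd[m,n]∣m m (m + n))))
    (gcd-greatest (gcd[m,n]∣m m n) (∣m∣n⇒∣m+n (gcd[m,n]∣m m n) (gcd[m,n]∣n m n)))

  shear : Frac → Frac
  shear (h , j) = h , h + j

  shear-injective : ∀ {x y} → shear x ≡ shear y → x ≡ y
  shear-injective {h , _} {_ , _} eq with cong proj₁ eq
  ... | refl = cong (h ,_) (+-cancelˡ-≡ h _ _ (cong proj₂ eq))

  swap-injective : ∀ {x y : Frac} → swap x ≡ swap y → x ≡ y
  swap-injective {_ , _} {_ , _} refl = refl

  module _ {n m : ℕ} (0<m : 0 < m) (m<n : m < n) where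
    private
      sheared : List Frac
      sheared = map shear (coprimePairs m (n ∸ m))

      inFareyNM? : Decidable (λ (x : Frac) → proj₁ x ≤ m × proj₂ x ∸ proj₁ x ≤ n ∸ m)
      inFareyNM? x = (proj₁ x ≤? m) ×-dec (proj₂ x ∸ proj₁ x ≤? n ∸ m)

      ∈-sheared⁻ : ∀ {x} → x ∈ sheared →
        ∃[ h ] ∃[ j ] x ≡ (h , h + j) × (1 ≤ h × h ≤ m) × (1 ≤ j × j ≤ n ∸ m) × gcd h j ≡ 1
      ∈-sheared⁻ x∈ with ∈-map⁻ shear x∈
      ... | (h , j) , hj∈ , refl = h , j , refl , ∈-coprimePairs⁻ hj∈

      Unique-sheared : Unique ((0 , 1) ∷ (1 , 1) ∷ sheared)
      Unique-sheared = All.tabulate (λ { (here refl) () ; (there x∈) refl → 0/1∉ x∈ })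
                     ∷ All.tabulate (λ { x∈ refl → 1/1∉ x∈ })
                     ∷ Unique.map⁺ shear-injective (Unique-coprimePairs m (n ∸ m))
        where
        0/1∉ : (0 , 1) ∉ sheared
        0/1∉ x∈ with ∈-sheared⁻ x∈
        ... | h , j , refl , (() , _) , _
        1/1∉ : (1 , 1) ∉ sheared
        1/1∉ x∈ with ∈-sheared⁻ x∈
        ... | h , j , eq , _ , (1≤j , _) , _ with cong proj₁ eq
        ... | refl = <⇒≢ 1≤j (sym (+-cancelˡ-≡ 1 j 0 (sym (cong proj₂ eq))))

      FareyNM⊆sheared : ∀ {x} → x ∈ FareyNM n m → x ∈ (0 , 1) ∷ (1 , 1) ∷ sheared
      FareyNM⊆sheared {h , k} x∈ with ∈-filter⁻ inFareyNM? {xs = Farey n} x∈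
      ... | x∈F , _ with ∈-Farey⁻ {n} x∈F
      FareyNM⊆sheared {zero  , k} _ | _ | _ , _ , gcd≡1 with gcd[0,n]≡1⇒n≡1 {k} gcd≡1
      ... | refl = here refl
      FareyNM⊆sheared {suc h , k} _ | _ , h≤m , k∸h≤n∸m | _ , h≤k , gcd≡1 with m≤n⇒m<n∨m≡n h≤k
      ... | inj₂ refl = there (here (cong (λ h → h , h) (trans (sym (gcd[n,n]≡n (suc h))) gcd≡1)))
      ... | inj₁ h<k  = there (there (subst (_∈ sheared) (cong (suc h ,_) (m+[n∸m]≡n h≤k)) (∈-map⁺ shear hj∈)))
        where
        gcd≡1′ : gcd (suc h) (k ∸ suc h) ≡ 1
        gcd≡1′ = trans (sym (gcd[m,m+n]≡gcd[m,n] (suc h) (k ∸ suc h)))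
                       (subst (λ k → gcd (suc h) k ≡ 1) (sym (m+[n∸m]≡n h≤k)) gcd≡1)
        hj∈ : (suc h , k ∸ suc h) ∈ coprimePairs m (n ∸ m)
        hj∈ = ∈-coprimePairs⁺ (s≤s z≤n) h≤m (m<n⇒0<n∸m h<k) k∸h≤n∸m gcd≡1′

      sheared⊆FareyNM : ∀ {x} → x ∈ (0 , 1) ∷ (1 , 1) ∷ sheared → x ∈ FareyNM n m
      sheared⊆FareyNM (here refl) =
        ∈-filter⁺ inFareyNM? (∈-Farey⁺ ≤-refl (<-trans 0<m m<n) z≤n refl) (z≤n , m<n⇒0<n∸m m<n)
      sheared⊆FareyNM (there (here refl)) =
        ∈-filter⁺ inFareyNM? (∈-Farey⁺ ≤-refl (<-trans 0<m m<n) ≤-refl refl) (0<m , z≤n)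
      sheared⊆FareyNM (there (there x∈)) with ∈-sheared⁻ x∈
      ... | h , j , refl , (1≤h , h≤m) , (1≤j , j≤n∸m) , gcd≡1 =
        ∈-filter⁺ inFareyNM?
          (∈-Farey⁺ (≤-trans 1≤j (m≤n+m j h)) h+j≤n (m≤m+n h j) (trans (gcd[m,m+n]≡gcd[m,n] h j) gcd≡1))
          (h≤m , subst (_≤ n ∸ m) (sym (m+n∸m≡n h j)) j≤n∸m)
        where
        h+j≤n : h + j ≤ n
        h+j≤n = subst (h + j ≤_) (m+[n∸m]≡n (<⇒≤ m<n)) (+-mono-≤ h≤m j≤n∸m)

    length-FareyNM≡2+length-coprimePairs : length (FareyNM n m) ≡ 2 + length (coprimePairs m (n ∸ m))
    length-FareyNM≡2+length-coprimePairs = trans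
      (length-cong-unique (Unique.filter⁺ inFareyNM? (Unique-Farey n)) Unique-sheared
                          (mk⇔ FareyNM⊆sheared sheared⊆FareyNM))
      (cong (_+_ 2) (length-map shear (coprimePairs m (n ∸ m))))

  h≤k? : Decidable (λ (x : Frac) → proj₁ x ≤ proj₂ x)
  h≤k? x = proj₁ x ≤? proj₂ x

  coprimePairs≤ coprimePairs> : ℕ → ℕ → List Frac
  coprimePairs≤ m n = filter h≤k? (coprimePairs m n)
  coprimePairs> m n = filter (¬? ∘ h≤k?) (coprimePairs m n)

  module _ {p q : ℕ} (1≤q : 1 ≤ q) where
    private
      h≤p? : Decidable (λ (x : Frac) → proj₁ x ≤ p)
      h≤p? x = proj₁ x ≤? p

      ∈-coprimePairs≤⁻ : ∀ {h k} → (h , k) ∈ coprimePairs≤ p q →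
                         h ≤ k × (1 ≤ h × h ≤ p) × (1 ≤ k × k ≤ q) × gcd h k ≡ 1
      ∈-coprimePairs≤⁻ x∈ with ∈-filter⁻ h≤k? {xs = coprimePairs p q} x∈
      ... | x∈′ , h≤k = h≤k , ∈-coprimePairs⁻ x∈′

      Unique-coprimePairs≤ : Unique ((0 , 1) ∷ coprimePairs≤ p q)
      Unique-coprimePairs≤ = All.tabulate (λ { x∈ refl → 0/1∉ x∈ })
                           ∷ Unique.filter⁺ h≤k? (Unique-coprimePairs p q)
        where
        0/1∉ : (0 , 1) ∉ coprimePairs≤ p q
        0/1∉ x∈ with ∈-coprimePairs≤⁻ x∈
        ... | _ , (() , _) , _

      FareyP⊆coprimePairs≤ : ∀ {x} → x ∈ FareyP q p → x ∈ (0 , 1) ∷ coprimePairs≤ p q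
      FareyP⊆coprimePairs≤ {h , k} x∈ with ∈-filter⁻ h≤p? {xs = Farey q} x∈
      ... | x∈F , h≤p with ∈-Farey⁻ {q} x∈F
      FareyP⊆coprimePairs≤ {zero , k} _ | _ | _ , _ , gcd≡1 with gcd[0,n]≡1⇒n≡1 {k} gcd≡1
      ... | refl = here refl
      FareyP⊆coprimePairs≤ {suc h , k} _ | _ , h≤p | (1≤k , k≤q) , h≤k , gcd≡1 =
        there (∈-filter⁺ h≤k? (∈-coprimePairs⁺ (s≤s z≤n) h≤p 1≤k k≤q gcd≡1) h≤k)

      coprimePairs≤⊆FareyP : ∀ {x} → x ∈ (0 , 1) ∷ coprimePairs≤ p q → x ∈ FareyP q p
      coprimePairs≤⊆FareyP (here refl) = ∈-filter⁺ h≤p? (∈-Farey⁺ ≤-refl 1≤q z≤n refl) z≤n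
      coprimePairs≤⊆FareyP {h , k} (there x∈) with ∈-coprimePairs≤⁻ x∈
      ... | h≤k , (_ , h≤p) , (1≤k , k≤q) , gcd≡1 =
        ∈-filter⁺ h≤p? (∈-Farey⁺ 1≤k k≤q h≤k gcd≡1) h≤p

    length-FareyP≡1+length-coprimePairs≤ : length (FareyP q p) ≡ suc (length (coprimePairs≤ p q))
    length-FareyP≡1+length-coprimePairs≤ =
      length-cong-unique (Unique.filter⁺ h≤p? (Unique-Farey q)) Unique-coprimePairs≤
                         (mk⇔ FareyP⊆coprimePairs≤ coprimePairs≤⊆FareyP)

  module _ {p q : ℕ} (1≤p : 1 ≤ p) (1≤q : 1 ≤ q) where
    private
      h≤q? : Decidable (λ (x : Frac) → proj₁ x ≤ q)
      h≤q? x = proj₁ x ≤? q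

      swapped : List Frac
      swapped = map swap (coprimePairs> p q)

      ∈-swapped⁻ : ∀ {h k} → (h , k) ∈ swapped →
                   h < k × (1 ≤ k × k ≤ p) × (1 ≤ h × h ≤ q) × gcd k h ≡ 1
      ∈-swapped⁻ x∈ with ∈-map⁻ swap x∈
      ... | (k , h) , x∈′ , refl with ∈-filter⁻ (¬? ∘ h≤k?) {xs = coprimePairs p q} x∈′
      ... | kh∈ , k≰h = ≰⇒> k≰h , ∈-coprimePairs⁻ kh∈

      Unique-swapped : Unique ((0 , 1) ∷ (1 , 1) ∷ swapped)
      Unique-swapped = All.tabulate (λ { (here refl) () ; (there x∈) refl → 0/1∉ x∈ })
                     ∷ All.tabulate (λ { x∈ refl → <-irrefl refl (proj₁ (∈-swapped⁻ x∈)) })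
                     ∷ Unique.map⁺ swap-injective (Unique.filter⁺ (¬? ∘ h≤k?) (Unique-coprimePairs p q))
        where
        0/1∉ : (0 , 1) ∉ swapped
        0/1∉ x∈ with ∈-swapped⁻ x∈
        ... | _ , _ , (() , _) , _

      FareyP⊆swapped : ∀ {x} → x ∈ FareyP p q → x ∈ (0 , 1) ∷ (1 , 1) ∷ swapped
      FareyP⊆swapped {h , k} x∈ with ∈-filter⁻ h≤q? {xs = Farey p} x∈
      ... | x∈F , h≤q with ∈-Farey⁻ {p} x∈F
      FareyP⊆swapped {zero , k} _ | _ | _ , _ , gcd≡1 with gcd[0,n]≡1⇒n≡1 {k} gcd≡1
      ... | refl = here refl
      FareyP⊆swapped {suc h , k} _ | _ , h≤q | (1≤k , k≤p) , h≤k , gcd≡1 with m≤n⇒m<n∨m≡n h≤k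
      ... | inj₂ refl = there (here (cong (λ h → h , h) (trans (sym (gcd[n,n]≡n (suc h))) gcd≡1)))
      ... | inj₁ h<k  = there (there (∈-map⁺ swap (∈-filter⁺ (¬? ∘ h≤k?) kh∈ (<⇒≱ h<k))))
        where
        kh∈ : (k , suc h) ∈ coprimePairs p q
        kh∈ = ∈-coprimePairs⁺ 1≤k k≤p (s≤s z≤n) h≤q (trans (gcd-comm k (suc h)) gcd≡1)

      swapped⊆FareyP : ∀ {x} → x ∈ (0 , 1) ∷ (1 , 1) ∷ swapped → x ∈ FareyP p q
      swapped⊆FareyP (here refl)         = ∈-filter⁺ h≤q? (∈-Farey⁺ ≤-refl 1≤p z≤n refl) z≤n
      swapped⊆FareyP (there (here refl)) = ∈-filter⁺ h≤q? (∈-Farey⁺ ≤-refl 1≤p ≤-refl refl) 1≤q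
      swapped⊆FareyP {h , k} (there (there x∈)) with ∈-swapped⁻ x∈
      ... | h<k , (1≤k , k≤p) , (_ , h≤q) , gcd≡1 =
        ∈-filter⁺ h≤q? (∈-Farey⁺ 1≤k k≤p (<⇒≤ h<k) (trans (gcd-comm h k) gcd≡1)) h≤q

    length-FareyP≡2+length-coprimePairs> : length (FareyP p q) ≡ 2 + length (coprimePairs> p q)
    length-FareyP≡2+length-coprimePairs> = trans
      (length-cong-unique (Unique.filter⁺ h≤q? (Unique-Farey p)) Unique-swapped
                          (mk⇔ FareyP⊆swapped swapped⊆FareyP))
      (cong (_+_ 2) (length-map swap (coprimePairs> p q)))

    length-FareyP+length-FareyP : length (FareyP q p) + length (FareyP p q) ≡ 3 + length (coprimePairs p q)
    length-FareyP+length-FareyP = begin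
      length (FareyP q p) + length (FareyP p q)
        ≡⟨ cong₂ _+_ (length-FareyP≡1+length-coprimePairs≤ 1≤q) length-FareyP≡2+length-coprimePairs> ⟩
      suc (length (coprimePairs≤ p q)) + (2 + length (coprimePairs> p q))
        ≡⟨ cong suc (+-suc (length (coprimePairs≤ p q)) (suc (length (coprimePairs> p q)))) ⟩
      2 + (length (coprimePairs≤ p q) + suc (length (coprimePairs> p q)))
        ≡⟨ cong (_+_ 2) (+-suc (length (coprimePairs≤ p q)) (length (coprimePairs> p q))) ⟩
      3 + (length (coprimePairs≤ p q) + length (coprimePairs> p q))
        ≡⟨ cong (_+_ 3) (length-filter-complement h≤k? (coprimePairs p q)) ⟩
      3 + length (coprimePairs p q) ∎
      where open ≡-Reasoning

open import Data.Integer using (_+_; _-_; _*_)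
open ≡-Reasoning

module _ {n m : ℕ} (0<m : 0 < m) (m<n : m < n) where

  length-FareyNM≡length-FareyP+length-FareyP-1 :
    + length (FareyNM n m) ≡ + length (FareyP (n ∸ m) m) + + length (FareyP m (n ∸ m)) - + 1
  length-FareyNM≡length-FareyP+length-FareyP-1 = begin
    + length (FareyNM n m)
      ≡⟨ cong +_ (length-FareyNM≡2+length-coprimePairs 0<m m<n) ⟩
    + (3 ℕ.+ length (coprimePairs m (n ∸ m))) - + 1
      ≡⟨ cong (λ l → + l - + 1) (sym (length-FareyP+length-FareyP 0<m (m<n⇒0<n∸m m<n))) ⟩
    + (length (FareyP (n ∸ m) m) ℕ.+ length (FareyP m (n ∸ m))) - + 1
      ≡⟨ cong (_- + 1) (ℤ.pos-+ (length (FareyP (n ∸ m) m)) (length (FareyP m (n ∸ m)))) ⟩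
    + length (FareyP (n ∸ m) m) + + length (FareyP m (n ∸ m)) - + 1 ∎

  length-FareyNM-2≡mobiusSum : + length (FareyNM n m) - + 2 ≡ mobiusSum m (n ∸ m)
  length-FareyNM-2≡mobiusSum = begin
    + length (FareyNM n m) - + 2        ≡⟨ cong (λ l → + l - + 2) (length-FareyNM≡2+length-coprimePairs 0<m m<n) ⟩
    + length (coprimePairs m (n ∸ m))   ≡⟨ length-coprimePairs≡mobiusSum m (n ∸ m) ⟩
    mobiusSum m (n ∸ m)                 ∎

module _ {t : ℕ} (0<t : 0 < t) where
  private
    2t∸t≡t : 2 ℕ.* t ∸ t ≡ t
    2t∸t≡t = trans (cong (λ s → t ℕ.+ s ∸ t) (+-identityʳ t)) (m+n∸m≡n t t)

    t<2t : t < 2 ℕ.* t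
    t<2t = subst (t <_) (cong (t ℕ.+_) (sym (+-identityʳ t))) (m<m+n t 0<t)

  mobiusSum[t,t]≡length-FareyNM[2t,t]-2 : mobiusSum t t ≡ + length (FareyNM (2 ℕ.* t) t) - + 2
  mobiusSum[t,t]≡length-FareyNM[2t,t]-2 =
    sym (subst (λ s → + length (FareyNM (2 ℕ.* t) t) - + 2 ≡ mobiusSum t s) 2t∸t≡t
               (length-FareyNM-2≡mobiusSum 0<t t<2t))

  length-FareyNM[2t,t]-2≡2*length-Farey-3 :
    + length (FareyNM (2 ℕ.* t) t) - + 2 ≡ + 2 * + length (Farey t) - + 3
  length-FareyNM[2t,t]-2≡2*length-Farey-3 = begin
    + length (FareyNM (2 ℕ.* t) t) - + 2
      ≡⟨ cong (_- + 2) length-FareyNM[2t,t] ⟩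
    + length (FareyP t t) + + length (FareyP t t) - + 1 - + 2
      ≡⟨ cong (λ F → + length F + + length F - + 1 - + 2) (FareyP-self t) ⟩
    + length (Farey t) + + length (Farey t) - + 1 - + 2
      ≡⟨ l+l-1-2≡2l-3 (+ length (Farey t)) ⟩
    + 2 * + length (Farey t) - + 3 ∎
    where
    length-FareyNM[2t,t] : + length (FareyNM (2 ℕ.* t) t) ≡ + length (FareyP t t) + + length (FareyP t t) - + 1
    length-FareyNM[2t,t] =
      subst (λ s → + length (FareyNM (2 ℕ.* t) t) ≡ + length (FareyP s t) + + length (FareyP t s) - + 1)
            2t∸t≡t (length-FareyNM≡length-FareyP+length-FareyP-1 0<t t<2t)
    l+l-1-2≡2l-3 : ∀ l → l + l - + 1 - + 2 ≡ + 2 * l - + 3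
    l+l-1-2≡2l-3 = solve-∀

mainTheorem3 :
    ((n m : ℕ) → 1 < n → 0 < m → m < n →
      (+ length (FareyNM n m)
         ≡ + length (FareyP (n ∸ m) m) + + length (FareyP m (n ∸ m)) - + 1)
      × (+ length (FareyNM n m) - + 2 ≡ mobiusSum m (n ∸ m)))
    × ((t : ℕ) → 0 < t →
      (mobiusSum t t ≡ + length (FareyNM (2 ℕ.* t) t) - + 2)
      × (+ length (FareyNM (2 ℕ.* t) t) - + 2 ≡ + 2 * + length (Farey t) - + 3))
mainTheorem3 =
  -- 1 < n is implied by 0 < m < n.
  (λ n m _ 0<m m<n → length-FareyNM≡length-FareyP+length-FareyP-1 0<m m<n , length-FareyNM-2≡mobiusSum 0<m m<n) ,
  (λ t 0<t → mobiusSum[t,t]≡length-FareyNM[2t,t]-2 0<t , length-FareyNM[2t,t]-2≡2*length-Farey-3 0<t)
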